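{- With notation as in the context, let $I$ be a transversal of $H$ in $A$ with $e\in I$ such that $I$ contains an element of ${\rm Sq}(G)$ in each coset of $H$ in $A$ having nonempty intersection with ${\rm Sq}(G)$. Then: (1) if $B\cup\{b^2\}\subseteq H$, then $(I\setminus\{e\})x$ is square-free for each $x\in H$; (2) if $B\leqslant H$ and $b^2\notin H$, then $(I\setminus\{e\})x$ is square-free for each $x\in H\setminus B$; (3) if $B\not\leqslant H$, $b^2\notin H\cup B$ and $Hb^2\cap B\neq\emptyset$, then $(I\setminus\{e\})x$ is square-free for each $x\in H\setminus(B\cup Bb^2)$; (4) if $B\not\leqslant H$, and either $b^2\in H\cup B$ or $Hb^2\cap B=\emptyset$, then $(I\setminus\{e\})x$ is square-free for each $x\in H\setminus B$.
   Context: Let $A$ be a finite abelian group of even order containing an involution $b^2$, and $G=\langle A,b : b^2\in A,\ b^4=e,\ bab^{ -1}=a^{ -1}\ (a\in A)\rangle$, $e$ the identity. Write $A=\langle a_1\rangle\times\cdots\times\langle a_{\lambda+\mu}\rangle$ with $o(a_i)=p_i^{e_i}$, $p_i$ prime, $e_1\le\cdots\le e_\lambda$, and $p_i=2$ iff $1\le i\le\lambda$. $B=\langle a_1^2\rangle\times\cdots\times\langle a_\lambda^2\rangle\times\langle a_{\lambda+1}\rangle\times\cdots\times\langle a_{\lambda+\mu}\rangle$. $H$ is a subgroup of $A$. ${\rm Sq}(G)=\{y^2:y\in G\}$. A transversal of $H$ in $A$ is a subset of $A$ containing exactly one element of each coset of $H$. A subset of $G$ is square-free if none of its elements lies in ${\rm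 Sq}(G)$. -}

module Defs where

open import Data.Nat using (ℕ; zero; suc; _+_; _*_; _∸_; _^_; _≤_; _<_)
open import Data.Nat.DivMod using (_%_; m%n<n)
open import Data.Nat.Divisibility using (_∣_)
open import Data.Nat.Primality using (Prime)
open import Data.Fin using (Fin; toℕ; fromℕ<)
open import Data.List using (List; []; _∷_; map; _++_)
open import Data.Nat.ListAction using (product)
open import Data.List.Relation.Unary.All using (All)
open import Data.List.Relation.Unary.Linked using (Linked)
open import Data.Product using (Σ; ∃; _×_; _,_)
open import Data.Bool using (Bool; true; false)
open import Data.Unit using (⊤; tt)
open import Relation.Binary.PropositionalEquality using (_≡_; _≢_)
open import Relation.Nullary using (¬_)

-- Cyclic group of order o (o ≥ 1), written additively:
-- ZMod o = {0, ..., o-1}, the residue k standing for a^k where o(a) = o.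
-- (All orders occurring below are 2^e or p^e with p prime, hence ≥ 1,
--  so suc (o ∸ 1) = o.)

ZMod : ℕ → Set
ZMod o = Fin (suc (o ∸ 1))

addMod : ∀ {o} → ZMod o → ZMod o → ZMod o
addMod {o} x y = fromℕ< (m%n<n (toℕ x + toℕ y) (suc (o ∸ 1)))

negMod : ∀ {o} → ZMod o → ZMod o
negMod {o} x = fromℕ< (m%n<n (suc (o ∸ 1) ∸ toℕ x) (suc (o ∸ 1)))

-- Direct product of cyclic groups <a_1> × ... × <a_k>, o(a_i) = os_i.
-- The tuple (k_1 , ... , k_k) stands for a_1^{k_1} ⋯ a_k^{k_k}.

Prod : List ℕ → Set
Prod []       = ⊤
Prod (o ∷ os) = ZMod o × Prod os

mulP : ∀ {os} → Prod os → Prod os → Prod os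
mulP {[]}     _        _        = tt
mulP {o ∷ os} (x , xs) (y , ys) = addMod {o} x y , mulP {os} xs ys

invP : ∀ {os} → Prod os → Prod os
invP {[]}     _        = tt
invP {o ∷ os} (x , xs) = negMod {o} x , invP {os} xs

idP : ∀ {os} → Prod os
idP {[]}     = tt
idP {o ∷ os} = Fin.zero , idP {os}

-- The finite abelian group A = <a_1> × ... × <a_{λ+μ}>.
--   es : exponents e_1 ≤ ... ≤ e_λ of the 2-primary factors (orders 2^{e_i}),
--   od : pairs (p_i , e_i), λ < i ≤ λ+μ, of the odd-prime factors.

ord2 : List ℕ → List ℕ
ord2 es = map (λ e → 2 ^ e) es

ordOdd : List (ℕ × ℕ) → List ℕ
ordOdd od = map (λ pe → Data.Product.proj₁ pe ^ Data.Product.proj₂ pe) od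

Ab : List ℕ → List (ℕ × ℕ) → Set
Ab es od = Prod (ord2 es) × Prod (ordOdd od)

record ValidDecomp (es : List ℕ) (od : List (ℕ × ℕ)) : Set where
  field
    es-pos    : All (λ e → 1 ≤ e) es
    es-sorted : Linked _≤_ es
    od-valid  : All (λ pe → Prime (Data.Product.proj₁ pe)
                          × Data.Product.proj₁ pe ≢ 2
                          × 1 ≤ Data.Product.proj₂ pe) od
    even-ord  : 2 ∣ product (ord2 es ++ ordOdd od)

module _ {es : List ℕ} {od : List (ℕ × ℕ)} where

  infixl 7 _·_
  _·_ : Ab es od → Ab es od → Ab es od
  (u , v) · (u' , v') = mulP u u' , mulP v v'

  inv : Ab es od → Ab es od
  inv (u , v) = invP u , invP v

  e : Ab es od
  e = idP , idP

  -- The group G = <A, b : b^2 = c, b^4 = e, b a b^{-1} = a^{-1}>,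
  -- for an involution c ∈ A.  Every element is uniquely a or a b (a ∈ A);
  -- we write (a , false) for a and (a , true) for a b.

  GDic : Set
  GDic = Ab es od × Bool

  mulG : (c : Ab es od) → GDic → GDic → GDic
  mulG c (a , false) (a' , false) = a · a' , false
  mulG c (a , false) (a' , true)  = a · a' , true
  mulG c (a , true)  (a' , false) = a · inv a' , true
  mulG c (a , true)  (a' , true)  = a · inv a' · c , false

  Sq : (c : Ab es od) → GDic → Set
  Sq c g = ∃ λ (y : GDic) → mulG c y y ≡ g

  SqA : (c : Ab es od) → Ab es od → Set
  SqA c a = Sq c (a , false)

  SquareFree : (c : Ab es od) → (Ab es od → Set) → Set
  SquareFree c S = ∀ a → S a → ¬ SqA c a

  record IsSubgroup (H : Ab es od → Set) : Set where
    field
      has-e   : H e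
      mul-cl  : ∀ {x y} → H x → H y → H (x · y)
      inv-cl  : ∀ {x} → H x → H (inv x)

  SameCoset : (H : Ab es od → Set) → Ab es od → Ab es od → Set
  SameCoset H x y = H (x · inv y)

  record IsTransversal (H : Ab es od → Set) (I : Ab es od → Set) : Set where
    field
      meets  : ∀ a → ∃ λ i → I i × SameCoset H i a
      unique : ∀ {i j} → I i → I j → SameCoset H i j → i ≡ j

  _⊆_ : (Ab es od → Set) → (Ab es od → Set) → Set
  S ⊆ T = ∀ x → S x → T x

  translate : (I : Ab es od → Set) → Ab es od → Ab es od → Set
  translate I x y = ∃ λ i → I i × i ≢ e × y ≡ i · x

  -- B = <a_1^2> × ... × <a_λ^2> × <a_{λ+1}> × ... × <a_{λ+μ}>

  InSqGen : ∀ {os} → Prod os → Set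
  InSqGen {[]}     _        = ⊤
  InSqGen {o ∷ os} (x , xs) = (∃ λ k → x ≡ fromℕ< (m%n<n (2 * k) (suc (o ∸ 1)))) × InSqGen {os} xs

  B : Ab es od → Set
  B (u , v) = InSqGen u

  Bc : (c : Ab es od) → Ab es od → Set
  Bc c x = ∃ λ β → B β × x ≡ β · c

{-# OPTIONS --safe #-}
-- In G the square of a ∈ A is a², and the square of ab is b² =: c; the 2-primary part of a² is a
-- square, so Sq(G) ∩ A ⊆ B ∪ {c}.  Let i ∈ I ∖ {e}, x ∈ H and suppose ix is a square.  The square
-- that I is assumed to contain in the coset H(ix) = Hi can only be i itself, so both i and ix lie
-- in B ∪ {c}.  Hence i ∉ H (the coset H is already represented by e) and x = i⁻¹(ix) ∈ B ∪ Bc,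
-- and each of (1)–(4) rules out the resulting cases.
module Submission where

open import Defs
open import Algebra.Bundles using (AbelianGroup)
open import Algebra.Structures using (IsAbelianGroup)
open import Algebra.Definitions using (Associative; Commutative; LeftIdentity; LeftInverse)
open import Algebra.Consequences.Propositional using (comm∧idˡ⇒id; comm∧invˡ⇒inv)
open import Data.Bool using (true; false)
open import Data.Empty using (⊥-elim)
open import Data.Fin using (Fin; toℕ; fromℕ<)
open import Data.Fin.Properties using (toℕ-fromℕ<; toℕ-injective; toℕ<n; fromℕ<-cong)
open import Data.List using (List; []; _∷_)
open import Data.Nat using (ℕ; suc; _+_; _*_; _∸_; NonZero)
open import Data.Nat.DivMod using (_%_; m%n<n; %-distribˡ-+; m%n%n≡m%n; m<n⇒m%n≡m; n%n≡0)
open import Data.Nat.Properties using (+-assoc; +-comm; +-identityʳ; m∸n+n≡m; <⇒≤)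
open import Data.Product using (∃; _×_; _,_; proj₁; map; zip′)
open import Data.Sum using (_⊎_; inj₁; inj₂; [_,_]′)
open import Data.Unit using (tt)
open import Function using (_∘_)
open import Level using (0ℓ; _⊔_)
open import Relation.Binary.PropositionalEquality
  using (_≡_; _≢_; refl; sym; trans; cong; cong₂; subst; isEquivalence; module ≡-Reasoning)
open import Relation.Nullary using (¬_)

isAbelianGroupˡ : ∀ {A : Set} {_∙_ : A → A → A} {ε : A} {_⁻¹ : A → A} →
                  Associative _≡_ _∙_ → Commutative _≡_ _∙_ →
                  LeftIdentity _≡_ ε _∙_ → LeftInverse _≡_ ε _⁻¹ _∙_ →
                  IsAbelianGroup _≡_ _∙_ ε _⁻¹
isAbelianGroupˡ {_∙_ = _∙_} {_⁻¹ = _⁻¹} assoc comm idˡ invˡ = record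
  { isGroup = record
    { isMonoid = record
      { isSemigroup = record
        { isMagma = record { isEquivalence = isEquivalence ; ∙-cong = cong₂ _∙_ }
        ; assoc   = assoc
        }
      ; identity = comm∧idˡ⇒id comm idˡ
      }
    ; inverse = comm∧invˡ⇒inv comm invˡ
    ; ⁻¹-cong = cong _⁻¹
    }
  ; comm = comm
  }

×-isAbelianGroup : ∀ {A B : Set} {_∙_ : A → A → A} {ε : A} {_⁻¹ : A → A}
                   {_∘_ : B → B → B} {η : B} {_⁻ : B → B} →
                   IsAbelianGroup _≡_ _∙_ ε _⁻¹ → IsAbelianGroup _≡_ _∘_ η _⁻ →
                   IsAbelianGroup _≡_ (zip′ _∙_ _∘_) (ε , η) (map _⁻¹ _⁻)
×-isAbelianGroup G K = isAbelianGroupˡ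
  (λ _ _ _ → cong₂ _,_ (G.assoc _ _ _) (K.assoc _ _ _))
  (λ _ _ → cong₂ _,_ (G.comm _ _) (K.comm _ _))
  (λ _ → cong₂ _,_ (G.identityˡ _) (K.identityˡ _))
  (λ _ → cong₂ _,_ (G.inverseˡ _) (K.inverseˡ _))
  where
  module G = IsAbelianGroup G
  module K = IsAbelianGroup K

module Squares {a ℓ} (G : AbelianGroup a ℓ) where
  open AbelianGroup G
  open import Algebra.Properties.AbelianGroup G using (⁻¹-∙-comm)
  open import Algebra.Properties.CommutativeSemigroup commutativeSemigroup using (interchange)
  open import Relation.Binary.Reasoning.Setoid setoid

  IsSquare : Carrier → Set (a ⊔ ℓ)
  IsSquare x = ∃ λ z → z ∙ z ≈ x

  ε-isSquare : IsSquare ε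
  ε-isSquare = ε , identityˡ ε

  ∙-isSquare : ∀ {x y} → IsSquare x → IsSquare y → IsSquare (x ∙ y)
  ∙-isSquare {x} {y} (z , z²≈x) (w , w²≈y) = z ∙ w , (begin
    (z ∙ w) ∙ (z ∙ w)  ≈⟨ interchange z w z w ⟩
    (z ∙ z) ∙ (w ∙ w)  ≈⟨ ∙-cong z²≈x w²≈y ⟩
    x ∙ y              ∎)

  ⁻¹-isSquare : ∀ {x} → IsSquare x → IsSquare (x ⁻¹)
  ⁻¹-isSquare {x} (z , z²≈x) = z ⁻¹ , (begin
    z ⁻¹ ∙ z ⁻¹  ≈⟨ ⁻¹-∙-comm z z ⟩
    (z ∙ z) ⁻¹   ≈⟨ ⁻¹-cong z²≈x ⟩
    x ⁻¹         ∎)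

[m%n+k]%n≡[m+k]%n : ∀ m k n .{{_ : NonZero n}} → (m % n + k) % n ≡ (m + k) % n
[m%n+k]%n≡[m+k]%n m k n = begin
  (m % n + k) % n          ≡⟨ %-distribˡ-+ (m % n) k n ⟩
  (m % n % n + k % n) % n  ≡⟨ cong (λ t → (t + k % n) % n) (m%n%n≡m%n m n) ⟩
  (m % n + k % n) % n      ≡⟨ %-distribˡ-+ m k n ⟨
  (m + k) % n              ∎
  where open ≡-Reasoning

[m+k%n]%n≡[m+k]%n : ∀ m k n .{{_ : NonZero n}} → (m + k % n) % n ≡ (m + k) % n
[m+k%n]%n≡[m+k]%n m k n = begin
  (m + k % n) % n  ≡⟨ cong (_% n) (+-comm m (k % n)) ⟩
  (k % n + m) % n  ≡⟨ [m%n+k]%n≡[m+k]%n k m n ⟩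
  (k + m) % n      ≡⟨ cong (_% n) (+-comm k m) ⟩
  (m + k) % n      ∎
  where open ≡-Reasoning

module _ {o : ℕ} where
  open ≡-Reasoning

  private
    N : ℕ
    N = suc (o ∸ 1)

  toℕ-addMod : ∀ (x y : ZMod o) → toℕ (addMod {o} x y) ≡ (toℕ x + toℕ y) % N
  toℕ-addMod x y = toℕ-fromℕ< (m%n<n (toℕ x + toℕ y) N)

  addMod-assoc : Associative _≡_ (addMod {o})
  addMod-assoc x y z = toℕ-injective (begin
    toℕ (addMod {o} (addMod {o} x y) z)  ≡⟨ toℕ-addMod (addMod {o} x y) z ⟩
    (toℕ (addMod {o} x y) + toℕ z) % N   ≡⟨ cong (λ t → (t + toℕ z) % N) (toℕ-addMod x y) ⟩
    ((toℕ x + toℕ y) % N + toℕ z) % N    ≡⟨ [m%n+k]%n≡[m+k]%n (toℕ x + toℕ y) (toℕ z) N ⟩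
    (toℕ x + toℕ y + toℕ z) % N          ≡⟨ cong (_% N) (+-assoc (toℕ x) (toℕ y) (toℕ z)) ⟩
    (toℕ x + (toℕ y + toℕ z)) % N        ≡⟨ [m+k%n]%n≡[m+k]%n (toℕ x) (toℕ y + toℕ z) N ⟨
    (toℕ x + (toℕ y + toℕ z) % N) % N    ≡⟨ cong (λ t → (toℕ x + t) % N) (toℕ-addMod y z) ⟨
    (toℕ x + toℕ (addMod {o} y z)) % N   ≡⟨ toℕ-addMod x (addMod {o} y z) ⟨
    toℕ (addMod {o} x (addMod {o} y z))  ∎)

  addMod-comm : Commutative _≡_ (addMod {o})
  addMod-comm x y = toℕ-injective (begin
    toℕ (addMod {o} x y)  ≡⟨ toℕ-addMod x y ⟩
    (toℕ x + toℕ y) % N   ≡⟨ cong (_% N) (+-comm (toℕ x) (toℕ y)) ⟩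
    (toℕ y + toℕ x) % N   ≡⟨ toℕ-addMod y x ⟨
    toℕ (addMod {o} y x)  ∎)

  addMod-identityˡ : LeftIdentity _≡_ Fin.zero (addMod {o})
  addMod-identityˡ x = toℕ-injective (trans (toℕ-addMod Fin.zero x) (m<n⇒m%n≡m (toℕ<n x)))

  negMod-inverseˡ : LeftInverse _≡_ Fin.zero (negMod {o}) (addMod {o})
  negMod-inverseˡ x = toℕ-injective (begin
    toℕ (addMod {o} (negMod {o} x) x)  ≡⟨ toℕ-addMod (negMod {o} x) x ⟩
    (toℕ (negMod {o} x) + toℕ x) % N   ≡⟨ cong (λ t → (t + toℕ x) % N) (toℕ-fromℕ< (m%n<n (N ∸ toℕ x) N)) ⟩
    ((N ∸ toℕ x) % N + toℕ x) % N      ≡⟨ [m%n+k]%n≡[m+k]%n (N ∸ toℕ x) (toℕ x) N ⟩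
    (N ∸ toℕ x + toℕ x) % N            ≡⟨ cong (_% N) (m∸n+n≡m (<⇒≤ (toℕ<n x))) ⟩
    N % N                              ≡⟨ n%n≡0 N ⟩
    0                                  ∎)

  addMod-double : ∀ (z : ZMod o) → addMod {o} z z ≡ fromℕ< (m%n<n (2 * toℕ z) N)
  addMod-double z =
    fromℕ<-cong _ _ (cong (λ t → (toℕ z + t) % N) (sym (+-identityʳ (toℕ z)))) _ _

  double-isSquare : ∀ k → ∃ λ (z : ZMod o) → addMod {o} z z ≡ fromℕ< (m%n<n (2 * k) N)
  double-isSquare k = z , toℕ-injective (begin
    toℕ (addMod {o} z z)            ≡⟨ toℕ-addMod z z ⟩
    (toℕ z + toℕ z) % N             ≡⟨ cong (λ t → (t + t) % N) (toℕ-fromℕ< (m%n<n k N)) ⟩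
    (k % N + k % N) % N             ≡⟨ %-distribˡ-+ k k N ⟨
    (k + k) % N                     ≡⟨ cong (λ t → (k + t) % N) (+-identityʳ k) ⟨
    (2 * k) % N                     ≡⟨ toℕ-fromℕ< (m%n<n (2 * k) N) ⟨
    toℕ (fromℕ< (m%n<n (2 * k) N))  ∎)
    where
    z : ZMod o
    z = fromℕ< (m%n<n k N)

ZMod-isAbelianGroup : ∀ o → IsAbelianGroup _≡_ (addMod {o}) Fin.zero (negMod {o})
ZMod-isAbelianGroup o =
  isAbelianGroupˡ (addMod-assoc {o}) (addMod-comm {o}) (addMod-identityˡ {o}) (negMod-inverseˡ {o})

Prod-isAbelianGroup : ∀ os → IsAbelianGroup _≡_ (mulP {os}) idP invP
Prod-isAbelianGroup []       = isAbelianGroupˡ (λ _ _ _ → refl) (λ _ _ → refl) (λ _ → refl) (λ _ → refl)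
Prod-isAbelianGroup (o ∷ os) = ×-isAbelianGroup (ZMod-isAbelianGroup o) (Prod-isAbelianGroup os)

Prod-abelianGroup : List ℕ → AbelianGroup 0ℓ 0ℓ
Prod-abelianGroup os = record { isAbelianGroup = Prod-isAbelianGroup os }

Ab-abelianGroup : (es : List ℕ) (od : List (ℕ × ℕ)) → AbelianGroup 0ℓ 0ℓ
Ab-abelianGroup es od = record
  { isAbelianGroup = ×-isAbelianGroup (Prod-isAbelianGroup (ord2 es)) (Prod-isAbelianGroup (ordOdd od)) }

module _ {es : List ℕ} {od : List (ℕ × ℕ)} where
  open AbelianGroup (Ab-abelianGroup es od) using (assoc; comm; identityˡ; identityʳ; inverseʳ)
  open import Algebra.Properties.AbelianGroup (Ab-abelianGroup es od)
    using (\\-leftDividesʳ; //-rightDividesʳ; xyx⁻¹≈y; ε⁻¹≈ε; identityʳ-unique)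
  open Squares using (IsSquare)
  open ≡-Reasoning

  module _ {H : Ab es od → Set} (H-isSubgroup : IsSubgroup H) where
    open IsSubgroup H-isSubgroup

    subgroup-cancelˡ : ∀ {a b} → H a → H (a · b) → H b
    subgroup-cancelˡ {a} {b} Ha Hab = subst H (\\-leftDividesʳ a b) (mul-cl (inv-cl Ha) Hab)

    subgroup-cancelʳ : ∀ {a b} → H b → H (a · b) → H a
    subgroup-cancelʳ {a} {b} Hb Hab = subst H (//-rightDividesʳ b a) (mul-cl Hab (inv-cl Hb))

    sameCoset-trans : ∀ {x y z} → SameCoset H x y → SameCoset H y z → SameCoset H x z
    sameCoset-trans {x} {y} {z} x~y y~z = subst H (begin
      x · inv y · (y · inv z)    ≡⟨ assoc x (inv y) (y · inv z) ⟩
      x · (inv y · (y · inv z))  ≡⟨ cong (x ·_) (\\-leftDividesʳ y (inv z)) ⟩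
      x · inv z                  ∎) (mul-cl x~y y~z)

    translate-sameCoset : ∀ {i x} → H x → SameCoset H (i · x) i
    translate-sameCoset {i} {x} Hx = subst H (sym (xyx⁻¹≈y i x)) Hx

    transversal-avoids-subgroup : ∀ {I} → IsTransversal H I → I e →
                                  ∀ {i} → I i → i ≢ e → ¬ H i
    transversal-avoids-subgroup I-isTransversal Ie {i} Ii i≢e Hi =
      i≢e (unique Ii Ie (subst H (sym (trans (cong (i ·_) ε⁻¹≈ε) (identityʳ i))) Hi))
      where open IsTransversal I-isTransversal

  isSquare⇒InSqGen : ∀ {os} {u : Prod os} → IsSquare (Prod-abelianGroup os) u → InSqGen {es} {od} u
  isSquare⇒InSqGen {[]}     _                 = tt
  isSquare⇒InSqGen {o ∷ os} ((z , zs) , refl) =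
    (toℕ z , addMod-double {o} z) , isSquare⇒InSqGen (zs , refl)

  InSqGen⇒isSquare : ∀ {os} {u : Prod os} → InSqGen {es} {od} u → IsSquare (Prod-abelianGroup os) u
  InSqGen⇒isSquare {[]}     _                  = tt , refl
  InSqGen⇒isSquare {o ∷ os} ((k , refl) , sqs) with double-isSquare {o} k | InSqGen⇒isSquare sqs
  ... | z , z²≡x | zs , zs²≡xs = (z , zs) , cong₂ _,_ z²≡x zs²≡xs

  B-isSubgroup : IsSubgroup {es} {od} B
  B-isSubgroup = record
    { has-e  = isSquare⇒InSqGen ε-isSquare
    ; mul-cl = λ Bx By → isSquare⇒InSqGen (∙-isSquare (InSqGen⇒isSquare Bx) (InSqGen⇒isSquare By))
    ; inv-cl = λ Bx → isSquare⇒InSqGen (⁻¹-isSquare (InSqGen⇒isSquare Bx))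
    }
    where open Squares (Prod-abelianGroup (ord2 es))

  SqA⇒B⊎≡c : ∀ {c a : Ab es od} → SqA c a → B a ⊎ a ≡ c
  SqA⇒B⊎≡c ((z , false) , refl) = inj₁ (isSquare⇒InSqGen (proj₁ z , refl))
  SqA⇒B⊎≡c {c} {a} ((z , true) , z²≡a) = inj₂ (begin
    a              ≡⟨ cong proj₁ z²≡a ⟨
    z · inv z · c  ≡⟨ cong (_· c) (inverseʳ z) ⟩
    e · c          ≡⟨ identityˡ c ⟩
    c              ∎)

  module _ (c : Ab es od) (c·c≡e : c · c ≡ e) where
    open IsSubgroup B-isSubgroup

    ·c-involutive : ∀ a → a · c · c ≡ a
    ·c-involutive a = begin
      a · c · c    ≡⟨ assoc a c c ⟩
      a · (c · c)  ≡⟨ cong (a ·_) c·c≡e ⟩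
      a · e        ≡⟨ identityʳ a ⟩
      a            ∎

    Bc⇒B[·c] : ∀ {x} → Bc c x → B (x · c)
    Bc⇒B[·c] (β , Bβ , refl) = subst B (sym (·c-involutive β)) Bβ

    Bc⊆B : B c → ∀ {x} → Bc c x → B x
    Bc⊆B Bc (β , Bβ , refl) = mul-cl {β} {c} Bβ Bc

    B∪c-cancelˡ : ∀ {i x} → B i ⊎ i ≡ c → B (i · x) ⊎ i · x ≡ c → B x ⊎ Bc c x
    B∪c-cancelˡ {i} {x} (inj₁ Bi) (inj₁ Bix) = inj₁ (subgroup-cancelˡ B-isSubgroup {i} {x} Bi Bix)
    B∪c-cancelˡ {i} {x} (inj₁ Bi) (inj₂ ix≡c) = inj₂ (inv i , inv-cl {i} Bi , (begin
      x                ≡⟨ \\-leftDividesʳ i x ⟨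
      inv i · (i · x)  ≡⟨ cong (inv i ·_) ix≡c ⟩
      inv i · c        ∎))
    B∪c-cancelˡ {x = x} (inj₂ refl) (inj₁ Bcx) = inj₂ (c · x , Bcx , (begin
      x          ≡⟨ ·c-involutive x ⟨
      x · c · c  ≡⟨ cong (_· c) (comm x c) ⟩
      c · x · c  ∎))
    B∪c-cancelˡ {x = x} (inj₂ refl) (inj₂ cx≡c) =
      inj₁ (subst B (sym (identityʳ-unique c x cx≡c)) has-e)

module SquareFreeTranslates
  {es : List ℕ} {od : List (ℕ × ℕ)} (c : Ab es od) (c·c≡e : c · c ≡ e)
  {H : Ab es od → Set} (H-isSubgroup : IsSubgroup H)
  {I : Ab es od → Set} (I-isTransversal : IsTransversal H I) (Ie : I e)
  (I-hasSquares : ∀ a → SqA c a → ∃ λ i → I i × SameCoset H i a × SqA c i)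
  where
  open IsTransversal I-isTransversal

  representative∈B∪c : ∀ {i x} → I i → H x → SqA c (i · x) → B i ⊎ i ≡ c
  representative∈B∪c {i} {x} Ii Hx sq with I-hasSquares (i · x) sq
  ... | j , Ij , j~ix , sqj = SqA⇒B⊎≡c (subst (SqA c) (unique Ij Ii j~i) sqj)
    where
    j~i : SameCoset H j i
    j~i = sameCoset-trans H-isSubgroup j~ix (translate-sameCoset H-isSubgroup Hx)

  translated∈B∪Bc : ∀ {i x} → I i → H x → SqA c (i · x) → B x ⊎ Bc c x
  translated∈B∪Bc Ii Hx sq = B∪c-cancelˡ c c·c≡e (representative∈B∪c Ii Hx sq) (SqA⇒B⊎≡c sq)

  squareFree-outside-B∪Bc : ∀ x → H x → ¬ B x → ¬ Bc c x → SquareFree c (translate I x)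
  squareFree-outside-B∪Bc x Hx x∉B x∉Bc _ (i , Ii , _ , refl) sq =
    [ x∉B , x∉Bc ]′ (translated∈B∪Bc Ii Hx sq)

  squareFree-B∪c⊆H : B ⊆ H → H c → ∀ x → H x → SquareFree c (translate I x)
  squareFree-B∪c⊆H B⊆H Hc x Hx _ (i , Ii , i≢e , refl) sq =
    transversal-avoids-subgroup H-isSubgroup I-isTransversal Ie Ii i≢e
      ([ B⊆H i , (λ { refl → Hc }) ]′ (representative∈B∪c Ii Hx sq))

  squareFree-B⊆H-c∉H : B ⊆ H → ¬ H c → ∀ x → H x → ¬ B x → SquareFree c (translate I x)
  squareFree-B⊆H-c∉H B⊆H c∉H x Hx x∉B = squareFree-outside-B∪Bc x Hx x∉B x∉Bc
    where
    x∉Bc : ¬ Bc c x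
    x∉Bc (β , Bβ , refl) = c∉H (subgroup-cancelˡ H-isSubgroup (B⊆H β Bβ) Hx)

  squareFree-outside-B-c∈H : H c → ∀ x → H x → ¬ B x → SquareFree c (translate I x)
  squareFree-outside-B-c∈H Hc x Hx x∉B _ (i , Ii , i≢e , refl) sq =
    x∉B (subgroup-cancelˡ B-isSubgroup {i} {x}
          (B-outside-H i∉H (representative∈B∪c Ii Hx sq))
          (B-outside-H ix∉H (SqA⇒B⊎≡c sq)))
    where
    i∉H : ¬ H i
    i∉H = transversal-avoids-subgroup H-isSubgroup I-isTransversal Ie Ii i≢e
    ix∉H : ¬ H (i · x)
    ix∉H = i∉H ∘ subgroup-cancelʳ H-isSubgroup Hx
    B-outside-H : ∀ {a} → ¬ H a → B a ⊎ a ≡ c → B a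
    B-outside-H _   (inj₁ Ba)  = Ba
    B-outside-H a∉H (inj₂ a≡c) = ⊥-elim (a∉H (subst H (sym a≡c) Hc))

  squareFree-outside-B : H c ⊎ B c ⊎ ¬ (∃ λ h → H h × B (h · c)) →
                         ∀ x → H x → ¬ B x → SquareFree c (translate I x)
  squareFree-outside-B (inj₁ Hc) = squareFree-outside-B-c∈H Hc
  squareFree-outside-B (inj₂ (inj₁ Bc)) x Hx x∉B =
    squareFree-outside-B∪Bc x Hx x∉B (x∉B ∘ Bc⊆B c c·c≡e Bc)
  squareFree-outside-B (inj₂ (inj₂ Hc∩B≡∅)) x Hx x∉B =
    squareFree-outside-B∪Bc x Hx x∉B (λ x∈Bc → Hc∩B≡∅ (x , Hx , Bc⇒B[·c] c c·c≡e x∈Bc))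

lemma3p5 : (es : List ℕ) (od : List (ℕ × ℕ)) → ValidDecomp es od →
           (c : Ab es od) → c ≢ e → c · c ≡ e →
           (H : Ab es od → Set) → IsSubgroup H →
           (I : Ab es od → Set) → IsTransversal H I → I e →
           (∀ a → SqA c a → ∃ λ i → I i × SameCoset H i a × SqA c i) →
           ((B ⊆ H) → H c →
              ∀ x → H x → SquareFree c (translate I x))
           × ((B ⊆ H) → ¬ H c →
              ∀ x → H x → ¬ B x → SquareFree c (translate I x))
           × (¬ (B ⊆ H) → ¬ H c → ¬ B c → (∃ λ h → H h × B (h · c)) →
              ∀ x → H x → ¬ B x → ¬ Bc c x → SquareFree c (translate I x))
           × (¬ (B ⊆ H) → (H c ⊎ B c ⊎ ¬ (∃ λ h → H h × B (h · c))) →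
              ∀ x → H x → ¬ B x → SquareFree c (translate I x))
lemma3p5 _ _ _ c _ c·c≡e _ H-isSubgroup _ I-isTransversal Ie I-hasSquares =
    squareFree-B∪c⊆H
  , squareFree-B⊆H-c∉H
  , (λ _ _ _ _ → squareFree-outside-B∪Bc)
  , (λ _ → squareFree-outside-B)
  where open SquareFreeTranslates c c·c≡e H-isSubgroup I-isTransversal Ie I-hasSquares
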